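{- Let $M=(E,G)$ be a full-rank, $I_5$-free and triangle-free binary matroid, and let $F$ be a flat of $G$ with $M|F\cong C_5$. Then the contraction $M/F$ is $I_3$-free.
   Context: A (simple binary) matroid is a pair $M=(E,G)$ where $G$ is a finite binary projective geometry identified with $\mathbb{F}_2^n\setminus\{0\}$ and $E\subseteq G$; $n$ is its dimension. $M$ is full-rank if $E$ spans $G$. A flat is a set $F\subseteq G$ with $\langle F\rangle:=F\cup\{0\}$ a subspace; $M|F=(E\cap F,F)$ is an induced restriction. Isomorphism of matroids is an isomorphism of geometries carrying ground set to ground set. $M$ is $N$-free if no induced restriction is isomorphic to $N$. A triangle is a 2-dimensional flat; triangle-free means $E$ contains no triangle. $I_n=(B,G)$ with $B$ a basis of an $n$-dimensional $G$. $C_n$ is the $(n-1)$-dimensional matroid whose ground set consists of $n$ points summing to zero. For a $k$-dimensional flat $F$, a coset of $F$ is a set $x+\langle F\rangle$ with $x\in G\setminus F$. The contraction $M/F$ is the matroid $(E_F,F')$ where $F'$ is an $(n-k)$-dimensional flat disjoint from $F$ and $E_F=\{x\in F' : E\cap(x+\langle F\rangle)\neq\varnothing\}$ (well defined up to isomorphism). -}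

module Defs where

open import Data.Bool using (Bool; true; false; _xor_; _∨_; _∧_; not; if_then_else_)
open import Data.Nat using (ℕ; zero; suc; _+_; _≡ᵇ_)
open import Data.Vec using (Vec; []; _∷_; zipWith; replicate)
open import Data.List using (List; foldr)
open import Data.List.Relation.Unary.All using (All)
open import Data.Product using (Σ; _×_; ∃; _,_)
open import Relation.Binary.PropositionalEquality using (_≡_; _≢_; refl)
open import Relation.Nullary using (¬_)

-- Points of the binary projective geometry of dimension n are the nonzero
-- vectors of F₂ⁿ; we work in the ambient vector space F₂ⁿ = Vec Bool n.
Pt : ℕ → Set
Pt n = Vec Bool n

_⊕_ : ∀ {n} → Pt n → Pt n → Pt n
_⊕_ = zipWith _xor_

𝟘 : ∀ {n} → Pt n
𝟘 {n} = replicate n false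

isZero : ∀ {n} → Pt n → Bool
isZero [] = true
isZero (b ∷ v) = not b ∧ isZero v

weight : ∀ {n} → Pt n → ℕ
weight [] = 0
weight (true ∷ v) = suc (weight v)
weight (false ∷ v) = weight v

anyVec : (k : ℕ) → (Pt k → Bool) → Bool
anyVec zero f = f []
anyVec (suc k) f = anyVec k (λ v → f (true ∷ v)) ∨ anyVec k (λ v → f (false ∷ v))

-- A simple binary matroid M = (E, G): G = F₂^dim ∖ {0}, E ⊆ G given by its
-- (decidable) indicator; E does not contain 0.
record Matroid : Set where
  field
    dim : ℕ
    E   : Pt dim → Bool
    E-0 : E 𝟘 ≡ false
open Matroid public

Linear : ∀ {k n} → (Pt k → Pt n) → Set
Linear f = ∀ x y → f (x ⊕ y) ≡ f x ⊕ f y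

Injective : ∀ {k n} → (Pt k → Pt n) → Set
Injective f = ∀ x y → f x ≡ f y → x ≡ y

-- An injective linear map F₂ᵏ → F₂ⁿ; its image minus 0 is a k-dimensional
-- flat, and every k-dimensional flat arises this way.
Embedding : ℕ → ℕ → Set
Embedding k n = Σ (Pt k → Pt n) (λ f → Linear f × Injective f)

-- The induced restriction M|F, where ⟨F⟩ = image of φ, is isomorphic to N
-- via the geometry isomorphism φ (which carries E(N) onto E(M) ∩ F).
RestrIso : (M : Matroid) (N : Matroid) → Embedding (dim N) (dim M) → Set
RestrIso M N (φ , _) = ∀ v → E M (φ v) ≡ E N v

Free : Matroid → Matroid → Set
Free M N = ¬ (Σ (Embedding (dim N) (dim M)) (λ φ → RestrIso M N φ))

FullRank : Matroid → Set
FullRank M = ∀ (v : Pt (dim M)) →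
  ∃ λ (xs : List (Pt (dim M))) → All (λ x → E M x ≡ true) xs × foldr _⊕_ 𝟘 xs ≡ v

TriangleFree : Matroid → Set
TriangleFree M = ∀ (x y : Pt (dim M)) → x ≢ y →
  E M x ≡ true → E M y ≡ true → E M (x ⊕ y) ≡ false

private
  weight-𝟘 : ∀ n → weight (𝟘 {n}) ≡ 0
  weight-𝟘 zero = refl
  weight-𝟘 (suc n) = weight-𝟘 n

  one-𝟘 : ∀ n → (weight (𝟘 {n}) ≡ᵇ 1) ≡ false
  one-𝟘 n rewrite weight-𝟘 n = refl

I : ℕ → Matroid
I n = record { dim = n ; E = λ v → weight v ≡ᵇ 1 ; E-0 = one-𝟘 n }

-- C_5: 4-dimensional, ground set {e₁,e₂,e₃,e₄, e₁+e₂+e₃+e₄}, five points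
-- summing to zero (any four of them form a basis).
C5 : Matroid
C5 = record { dim = 4 ; E = λ v → (weight v ≡ᵇ 1) ∨ (weight v ≡ᵇ 4) ; E-0 = refl }

Complementary : ∀ {k m n} → Embedding k n → Embedding m n → Set
Complementary (φ , _) (χ , _) = ∀ u a → χ u ≡ φ a → u ≡ 𝟘

private
  isZero-𝟘 : ∀ n → isZero (𝟘 {n}) ≡ true
  isZero-𝟘 zero = refl
  isZero-𝟘 (suc n) = isZero-𝟘 n

  contrE-0 : ∀ m (b : Bool) → (not (isZero (𝟘 {m})) ∧ b) ≡ false
  contrE-0 m b rewrite isZero-𝟘 m = refl

-- Contraction M/F with ⟨F⟩ = image φ, realised on the complementary flat
-- F' with ⟨F'⟩ = image χ (coordinatised by F₂ᵐ):
-- E_F = {x ∈ F' : E ∩ (x + ⟨F⟩) ≠ ∅}.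
contraction : (M : Matroid) {k m : ℕ} → Embedding k (dim M) → Embedding m (dim M) → Matroid
contraction M {k} {m} (φ , _) (χ , _) = record
  { dim = m
  ; E = λ u → not (isZero u) ∧ anyVec k (λ a → E M (χ u ⊕ φ a))
  ; E-0 = contrE-0 m _
  }

module Submission where

-- Put the C₅ on ⟨F⟩ and let the I₃ of M/F sit on the cosets x₁ + ⟨F⟩,
-- x₂ + ⟨F⟩, x₃ + ⟨F⟩.  Pull E ∩ (xᵢ + ⟨F⟩) back to a nonempty set Sᵢ ⊆ F₂⁴.
-- Triangle-freeness says that no sum of two points of Sᵢ lies in C₅, so the
-- stabiliser {v : Sᵢ + v ⊆ Sᵢ} is a subspace avoiding C₅; since C₅ meets
-- every hyperplane, it has at most three nonzero points.  Three stabilisers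
-- cannot cover the ten nonzero points off C₅, so there are c, d ∈ C₅ and
-- aᵢ ∈ Sᵢ with aᵢ + c + d ∉ Sᵢ for each i.  Then x₁ + a₁, x₂ + a₂, x₃ + a₃,
-- c, d span an induced I₅: the cosets of xᵢ + xⱼ and x₁ + x₂ + x₃ miss E,
-- and aᵢ + c, aᵢ + d ∉ Sᵢ again by triangle-freeness.

open import Defs
open import Data.Bool using (Bool; true; false; _∧_; not; if_then_else_)
import Data.Bool.Properties as Bool
open import Data.Nat using (ℕ; zero; suc; _+_; _≤_; _<_; _≤?_; _≡ᵇ_; z≤n; s≤s)
import Data.Nat.Properties as ℕ
open import Data.Fin using (Fin)
import Data.Fin.Properties as Fin
open import Data.Fin.Subset using (Subset; _∈_; _∉_; _∪_; ∣_∣; ⊤; inside; outside)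
open import Data.Fin.Subset.Properties
  using (_∈?_; anySubset?; ∣⊤∣≡n; p⊆q⇒∣p∣≤∣q∣; x∈p∪q⁺)
open import Data.Vec using (Vec; []; _∷_; lookup; tabulate)
import Data.Vec.Properties as Vec
open import Data.Product using (Σ; ∃; ∃₂; _×_; _,_; proj₁; proj₂)
import Data.Product as Product
open import Data.Sum using (_⊎_; inj₁; inj₂)
open import Function using (_∘_; id)
open import Relation.Binary.PropositionalEquality
  using (_≡_; _≢_; refl; sym; trans; cong; cong₂; subst; module ≡-Reasoning)
open import Relation.Nullary using (¬_; Dec; yes; no; does; contradiction)
open import Relation.Nullary.Decidable
  using (_×-dec_; _→-dec_; ¬?; map′; from-yes; from-no; decidable-stable; dec-true; dec-false)
open import Relation.Unary using (Pred; Decidable)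

open ≡-Reasoning

-- The vector space F₂ⁿ

infix 4 _≟ᵥ_
_≟ᵥ_ : ∀ {n} (x y : Pt n) → Dec (x ≡ y)
_≟ᵥ_ = Vec.≡-dec Bool._≟_

⊕-comm : ∀ {n} (x y : Pt n) → x ⊕ y ≡ y ⊕ x
⊕-comm = Vec.zipWith-comm Bool.xor-comm

⊕-assoc : ∀ {n} (x y z : Pt n) → (x ⊕ y) ⊕ z ≡ x ⊕ (y ⊕ z)
⊕-assoc = Vec.zipWith-assoc Bool.xor-assoc

⊕-identityˡ : ∀ {n} (x : Pt n) → 𝟘 ⊕ x ≡ x
⊕-identityˡ = Vec.zipWith-identityˡ Bool.xor-identityˡ

⊕-identityʳ : ∀ {n} (x : Pt n) → x ⊕ 𝟘 ≡ x
⊕-identityʳ = Vec.zipWith-identityʳ Bool.xor-identityʳ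

⊕-self : ∀ {n} (x : Pt n) → x ⊕ x ≡ 𝟘
⊕-self []      = refl
⊕-self (b ∷ x) = cong₂ _∷_ (Bool.xor-same b) (⊕-self x)

x⊕[x⊕y]≡y : ∀ {n} (x y : Pt n) → x ⊕ (x ⊕ y) ≡ y
x⊕[x⊕y]≡y x y = begin
  x ⊕ (x ⊕ y)  ≡⟨ ⊕-assoc x x y ⟨
  (x ⊕ x) ⊕ y  ≡⟨ cong (_⊕ y) (⊕-self x) ⟩
  𝟘 ⊕ y        ≡⟨ ⊕-identityˡ y ⟩
  y            ∎

⊕-interchange : ∀ {n} (x y z w : Pt n) → (x ⊕ y) ⊕ (z ⊕ w) ≡ (x ⊕ z) ⊕ (y ⊕ w)
⊕-interchange x y z w = begin
  (x ⊕ y) ⊕ (z ⊕ w)  ≡⟨ ⊕-assoc x y (z ⊕ w) ⟩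
  x ⊕ (y ⊕ (z ⊕ w))  ≡⟨ cong (x ⊕_) (⊕-assoc y z w) ⟨
  x ⊕ ((y ⊕ z) ⊕ w)  ≡⟨ cong (λ u → x ⊕ (u ⊕ w)) (⊕-comm y z) ⟩
  x ⊕ ((z ⊕ y) ⊕ w)  ≡⟨ cong (x ⊕_) (⊕-assoc z y w) ⟩
  x ⊕ (z ⊕ (y ⊕ w))  ≡⟨ ⊕-assoc x z (y ⊕ w) ⟨
  (x ⊕ z) ⊕ (y ⊕ w)  ∎

[x⊕y]⊕[x⊕z]≡y⊕z : ∀ {n} (x y z : Pt n) → (x ⊕ y) ⊕ (x ⊕ z) ≡ y ⊕ z
[x⊕y]⊕[x⊕z]≡y⊕z x y z = begin
  (x ⊕ y) ⊕ (x ⊕ z)  ≡⟨ ⊕-interchange x y x z ⟩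
  (x ⊕ x) ⊕ (y ⊕ z)  ≡⟨ cong (_⊕ (y ⊕ z)) (⊕-self x) ⟩
  𝟘 ⊕ (y ⊕ z)        ≡⟨ ⊕-identityˡ (y ⊕ z) ⟩
  y ⊕ z              ∎

⊕≡𝟘⇒≡ : ∀ {n} {x y : Pt n} → x ⊕ y ≡ 𝟘 → x ≡ y
⊕≡𝟘⇒≡ {x = x} {y} x⊕y≡𝟘 = begin
  x            ≡⟨ ⊕-identityʳ x ⟨
  x ⊕ 𝟘        ≡⟨ cong (x ⊕_) x⊕y≡𝟘 ⟨
  x ⊕ (x ⊕ y)  ≡⟨ x⊕[x⊕y]≡y x y ⟩
  y            ∎

⊕-cancelˡ : ∀ {n} (z : Pt n) {x y : Pt n} → z ⊕ x ≡ z ⊕ y → x ≡ y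
⊕-cancelˡ z {x} {y} eq = begin
  x            ≡⟨ x⊕[x⊕y]≡y z x ⟨
  z ⊕ (z ⊕ x)  ≡⟨ cong (z ⊕_) eq ⟩
  z ⊕ (z ⊕ y)  ≡⟨ x⊕[x⊕y]≡y z y ⟩
  y            ∎

isZero⇒≡𝟘 : ∀ {n} (x : Pt n) → isZero x ≡ true → x ≡ 𝟘
isZero⇒≡𝟘 []          _ = refl
isZero⇒≡𝟘 (false ∷ x) e = cong (false ∷_) (isZero⇒≡𝟘 x e)

linear-𝟘 : ∀ {k n} {f : Pt k → Pt n} → Linear f → f 𝟘 ≡ 𝟘
linear-𝟘 {f = f} f-lin = begin
  f 𝟘            ≡⟨ cong f (⊕-self 𝟘) ⟨
  f (𝟘 ⊕ 𝟘)      ≡⟨ f-lin 𝟘 𝟘 ⟩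
  f 𝟘 ⊕ f 𝟘      ≡⟨ ⊕-self (f 𝟘) ⟩
  𝟘              ∎

∘-linear : ∀ {j k n} {f : Pt k → Pt n} {g : Pt j → Pt k} → Linear f → Linear g → Linear (f ∘ g)
∘-linear {f = f} {g} f-lin g-lin x y = trans (cong f (g-lin x y)) (f-lin (g x) (g y))

trivialKernel⇒injective : ∀ {k n} {f : Pt k → Pt n} → Linear f →
  (∀ x → f x ≡ 𝟘 → x ≡ 𝟘) → Injective f
trivialKernel⇒injective {f = f} f-lin ker x y fx≡fy =
  ⊕≡𝟘⇒≡ (ker (x ⊕ y) (trans (f-lin x y) (trans (cong (_⊕ f y) fx≡fy) (⊕-self (f y)))))

linComb : ∀ {k n} → Vec (Pt n) k → Pt k → Pt n
linComb []       []       = 𝟘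
linComb (v ∷ vs) (x ∷ xs) = if x then v ⊕ linComb vs xs else linComb vs xs

linComb-linear : ∀ {k n} (vs : Vec (Pt n) k) → Linear (linComb vs)
linComb-linear []       []           []           = sym (⊕-self 𝟘)
linComb-linear (v ∷ vs) (false ∷ xs) (false ∷ ys) = linComb-linear vs xs ys
linComb-linear (v ∷ vs) (true  ∷ xs) (false ∷ ys) = begin
  v ⊕ linComb vs (xs ⊕ ys)                     ≡⟨ cong (v ⊕_) (linComb-linear vs xs ys) ⟩
  v ⊕ (linComb vs xs ⊕ linComb vs ys)          ≡⟨ ⊕-assoc v _ _ ⟨
  (v ⊕ linComb vs xs) ⊕ linComb vs ys          ∎
linComb-linear (v ∷ vs) (false ∷ xs) (true  ∷ ys) = begin
  v ⊕ linComb vs (xs ⊕ ys)                     ≡⟨ cong (v ⊕_) (linComb-linear vs xs ys) ⟩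
  v ⊕ (linComb vs xs ⊕ linComb vs ys)          ≡⟨ ⊕-assoc v _ _ ⟨
  (v ⊕ linComb vs xs) ⊕ linComb vs ys          ≡⟨ cong (_⊕ linComb vs ys) (⊕-comm v _) ⟩
  (linComb vs xs ⊕ v) ⊕ linComb vs ys          ≡⟨ ⊕-assoc _ v _ ⟩
  linComb vs xs ⊕ (v ⊕ linComb vs ys)          ∎
linComb-linear (v ∷ vs) (true  ∷ xs) (true  ∷ ys) = begin
  linComb vs (xs ⊕ ys)                         ≡⟨ linComb-linear vs xs ys ⟩
  linComb vs xs ⊕ linComb vs ys                ≡⟨ [x⊕y]⊕[x⊕z]≡y⊕z v _ _ ⟨
  (v ⊕ linComb vs xs) ⊕ (v ⊕ linComb vs ys)    ∎

anyVec-witness : ∀ k (P : Pt k → Bool) → anyVec k P ≡ true → ∃ λ v → P v ≡ true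
anyVec-witness zero    P e = [] , e
anyVec-witness (suc k) P e with anyVec k (P ∘ (true ∷_)) in found
... | true  = Product.map (true ∷_) id (anyVec-witness k _ found)
... | false = Product.map (false ∷_) id (anyVec-witness k _ e)

anyVec-false : ∀ k (P : Pt k → Bool) → anyVec k P ≡ false → ∀ v → P v ≡ false
anyVec-false zero    P e []          = e
anyVec-false (suc k) P e (b ∷ v) with anyVec k (P ∘ (true ∷_)) in none
anyVec-false (suc k) P e (true  ∷ v) | false = anyVec-false k _ none v
anyVec-false (suc k) P e (false ∷ v) | false = anyVec-false k _ e v

allSubset? : ∀ {n ℓ} {P : Pred (Subset n) ℓ} → Decidable P → Dec (∀ p → P p)
allSubset? P? = map′ (λ ¬∃¬ p → decidable-stable (P? p) (λ ¬Pp → ¬∃¬ (p , ¬Pp)))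
                     (λ ∀P (p , ¬Pp) → ¬Pp (∀P p))
                     (¬? (anySubset? (¬? ∘ P?)))

-- Stabilisers

Stabilises : ∀ {n} → (Pt n → Bool) → Pt n → Set
Stabilises S v = ∀ a → S a ≡ true → S (a ⊕ v) ≡ true

Moves : ∀ {n} → (Pt n → Bool) → Pt n → Set
Moves S v = ∃ λ a → S a ≡ true × S (a ⊕ v) ≡ false

stabilises⊎moves : ∀ {n} (S : Pt n → Bool) v → Stabilises S v ⊎ Moves S v
stabilises⊎moves {n} S v with anyVec n (λ a → S a ∧ not (S (a ⊕ v))) in search
... | true  = inj₂ (moved (anyVec-witness n _ search))
  where
  moved : ∃ (λ a → (S a ∧ not (S (a ⊕ v))) ≡ true) → Moves S v
  moved (a , e) with S a in Sa | S (a ⊕ v) in Sa⊕v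
  moved (a , e) | true | false = a , Sa , Sa⊕v
... | false = inj₁ λ a Sa → kept Sa (anyVec-false n _ search a)
  where
  kept : ∀ {x y} → x ≡ true → (x ∧ not y) ≡ false → y ≡ true
  kept {y = true}  _    _  = refl
  kept {y = false} refl ()

stabilises? : ∀ {n} (S : Pt n → Bool) v → Dec (Stabilises S v)
stabilises? S v with stabilises⊎moves S v
... | inj₁ st                  = yes st
... | inj₂ (a , Sa , Sa⊕v∉S)  = no λ st → contradiction (trans (sym (st a Sa)) Sa⊕v∉S) λ ()

¬stabilises⇒moves : ∀ {n} {S : Pt n → Bool} {v} → ¬ Stabilises S v → Moves S v
¬stabilises⇒moves {S = S} {v} ¬st with stabilises⊎moves S v
... | inj₁ st    = contradiction st ¬st
... | inj₂ moves = moves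

stabilises-⊕ : ∀ {n} {S : Pt n → Bool} {u v} → Stabilises S u → Stabilises S v → Stabilises S (u ⊕ v)
stabilises-⊕ {S = S} {u} {v} st-u st-v a Sa =
  subst (λ x → S x ≡ true) (⊕-assoc a u v) (st-v (a ⊕ u) (st-u a Sa))

SumAvoids : ∀ {n} → (X S : Pt n → Bool) → Set
SumAvoids X S = ∀ a b → S a ≡ true → S b ≡ true → X (a ⊕ b) ≡ false

stabiliser-avoids : ∀ {n} {X S : Pt n → Bool} → SumAvoids X S →
  ∀ {a v} → S a ≡ true → Stabilises S v → X v ≡ false
stabiliser-avoids {X = X} avoids {a} {v} Sa st =
  subst (λ x → X x ≡ false) (x⊕[x⊕y]≡y a v) (avoids a (a ⊕ v) Sa (st a Sa))

shift-leaves : ∀ {n} {X S : Pt n → Bool} → SumAvoids X S →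
  ∀ {a v} → S a ≡ true → X v ≡ true → S (a ⊕ v) ≡ false
shift-leaves {X = X} {S} avoids {a} {v} Sa Xv with S (a ⊕ v) in Sa⊕v
... | false = refl
... | true  = contradiction (trans (sym Xv) Xv≡false) λ ()
  where
  Xv≡false : X v ≡ false
  Xv≡false = subst (λ x → X x ≡ false) (x⊕[x⊕y]≡y a v) (avoids a (a ⊕ v) Sa Sa⊕v)

-- The ten points of PG(3,2) off C₅

offC5 : Fin 10 → Pt 4
offC5 = lookup
  ( (true  ∷ true  ∷ false ∷ false ∷ [])
  ∷ (true  ∷ false ∷ true  ∷ false ∷ [])
  ∷ (true  ∷ false ∷ false ∷ true  ∷ [])
  ∷ (false ∷ true  ∷ true  ∷ false ∷ [])
  ∷ (false ∷ true  ∷ false ∷ true  ∷ [])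
  ∷ (false ∷ false ∷ true  ∷ true  ∷ [])
  ∷ (false ∷ true  ∷ true  ∷ true  ∷ [])
  ∷ (true  ∷ false ∷ true  ∷ true  ∷ [])
  ∷ (true  ∷ true  ∷ false ∷ true  ∷ [])
  ∷ (true  ∷ true  ∷ true  ∷ false ∷ [])
  ∷ [])

-- Opaque, so that unification never unfolds these exhaustive searches.
opaque
  offC5-off : ∀ j → offC5 j ≢ 𝟘 × E C5 (offC5 j) ≡ false
  offC5-off = from-yes (Fin.all? λ j → ¬? (offC5 j ≟ᵥ 𝟘) ×-dec E C5 (offC5 j) Bool.≟ false)

  offC5-surjective : ∀ v → v ≢ 𝟘 → E C5 v ≡ false → ∃ λ j → offC5 j ≡ v
  offC5-surjective = from-yes (allSubset? λ v →
    ¬? (v ≟ᵥ 𝟘) →-dec E C5 v Bool.≟ false →-dec Fin.any? λ j → offC5 j ≟ᵥ v)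

  C5-chord : ∀ v → E C5 v ≡ false → ∃₂ λ c d → E C5 c ≡ true × E C5 d ≡ true × c ⊕ d ≡ v
  C5-chord = from-yes (allSubset? λ v → E C5 v Bool.≟ false →-dec
    anySubset? λ c → anySubset? λ d → E C5 c Bool.≟ true ×-dec E C5 d Bool.≟ true ×-dec c ⊕ d ≟ᵥ v)

-- The closed subsets are exactly the nonzero parts of subspaces avoiding C₅.
Closed : Subset 10 → Set
Closed p = ∀ i j → i ∈ p → j ∈ p → offC5 i ≢ offC5 j →
  ∃ λ k → k ∈ p × offC5 k ≡ offC5 i ⊕ offC5 j

closed? : ∀ p → Dec (Closed p)
closed? p = Fin.all? λ i → Fin.all? λ j → i ∈? p →-dec j ∈? p →-dec ¬? (offC5 i ≟ᵥ offC5 j) →-dec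
  Fin.any? λ k → k ∈? p ×-dec offC5 k ≟ᵥ offC5 i ⊕ offC5 j

closed⇒∣p∣≤3 : ∀ p → Closed p → ∣ p ∣ ≤ 3
closed⇒∣p∣≤3 p closed = decidable-stable (∣ p ∣ ≤? 3) λ ∣p∣≰3 → noLargeClosed (p , closed , ∣p∣≰3)
  where
  noLargeClosed : ¬ ∃ λ p → Closed p × ¬ ∣ p ∣ ≤ 3
  noLargeClosed = from-no (anySubset? λ p → closed? p ×-dec ¬? (∣ p ∣ ≤? 3))

∣p∪q∣≤∣p∣+∣q∣ : ∀ {n} (p q : Subset n) → ∣ p ∪ q ∣ ≤ ∣ p ∣ + ∣ q ∣
∣p∪q∣≤∣p∣+∣q∣ []            []            = z≤n
∣p∪q∣≤∣p∣+∣q∣ (outside ∷ p) (outside ∷ q) = ∣p∪q∣≤∣p∣+∣q∣ p q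
∣p∪q∣≤∣p∣+∣q∣ (inside  ∷ p) (outside ∷ q) = s≤s (∣p∪q∣≤∣p∣+∣q∣ p q)
∣p∪q∣≤∣p∣+∣q∣ (outside ∷ p) (inside  ∷ q) =
  subst (suc ∣ p ∪ q ∣ ≤_) (sym (ℕ.+-suc ∣ p ∣ ∣ q ∣)) (s≤s (∣p∪q∣≤∣p∣+∣q∣ p q))
∣p∪q∣≤∣p∣+∣q∣ (inside  ∷ p) (inside  ∷ q) =
  s≤s (ℕ.≤-trans (∣p∪q∣≤∣p∣+∣q∣ p q) (ℕ.+-monoʳ-≤ ∣ p ∣ (ℕ.n≤1+n ∣ q ∣)))

∣p∣<n⇒∃∉ : ∀ {n} (p : Subset n) → ∣ p ∣ < n → ∃ λ x → x ∉ p
∣p∣<n⇒∃∉ {n} p ∣p∣<n = Fin.¬∀⟶∃¬ n (_∈ p) (_∈? p) λ all∈ →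
  ℕ.<⇒≱ ∣p∣<n (subst (_≤ ∣ p ∣) (∣⊤∣≡n n) (p⊆q⇒∣p∣≤∣q∣ {p = ⊤} {q = p} λ {x} _ → all∈ x))

stabiliser : (Pt 4 → Bool) → Subset 10
stabiliser S = tabulate λ j → does (stabilises? S (offC5 j))

module _ {S : Pt 4 → Bool} {j : Fin 10} where

  private
    lookup-stabiliser : lookup (stabiliser S) j ≡ does (stabilises? S (offC5 j))
    lookup-stabiliser = Vec.lookup∘tabulate (λ i → does (stabilises? S (offC5 i))) j

  ∈stabiliser⇒ : j ∈ stabiliser S → Stabilises S (offC5 j)
  ∈stabiliser⇒ j∈ = decidable-stable (stabilises? S (offC5 j)) λ ¬st →
    contradiction (trans (sym member) (dec-false (stabilises? S (offC5 j)) ¬st)) λ ()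
    where
    member : does (stabilises? S (offC5 j)) ≡ true
    member = trans (sym lookup-stabiliser) (Vec.[]=⇒lookup j∈)

  ⇒∈stabiliser : Stabilises S (offC5 j) → j ∈ stabiliser S
  ⇒∈stabiliser st = Vec.lookup⇒[]= j _ (trans lookup-stabiliser (dec-true (stabilises? S (offC5 j)) st))

stabiliser-closed : ∀ {S} → SumAvoids (E C5) S → ∃ (λ a → S a ≡ true) → Closed (stabiliser S)
stabiliser-closed {S} avoids (a , Sa) i j i∈ j∈ i≢j =
  let k , k≡ = offC5-surjective _ (i≢j ∘ ⊕≡𝟘⇒≡) (stabiliser-avoids {X = E C5} avoids Sa st)
  in  k , ⇒∈stabiliser (subst (Stabilises S) (sym k≡) st) , k≡
  where
  st : Stabilises S (offC5 i ⊕ offC5 j)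
  st = stabilises-⊕ (∈stabiliser⇒ i∈) (∈stabiliser⇒ j∈)

∣stabiliser∣≤3 : ∀ {S} → SumAvoids (E C5) S → ∃ (λ a → S a ≡ true) → ∣ stabiliser S ∣ ≤ 3
∣stabiliser∣≤3 avoids nonempty = closed⇒∣p∣≤3 _ (stabiliser-closed avoids nonempty)

common-moving-offC5 : ∀ {S₁ S₂ S₃} →
  ∣ stabiliser S₁ ∣ ≤ 3 → ∣ stabiliser S₂ ∣ ≤ 3 → ∣ stabiliser S₃ ∣ ≤ 3 →
  ∃ λ j → Moves S₁ (offC5 j) × Moves S₂ (offC5 j) × Moves S₃ (offC5 j)
common-moving-offC5 {S₁} {S₂} {S₃} small₁ small₂ small₃ =
  j , moves {S₁} (∈ˡ ∘ ∈ˡ) , moves {S₂} (∈ˡ ∘ ∈ʳ {p₁}) , moves {S₃} (∈ʳ {p₁ ∪ p₂})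
  where
  p₁ = stabiliser S₁
  p₂ = stabiliser S₂
  p₃ = stabiliser S₃
  ∣p∣≤9 : ∣ (p₁ ∪ p₂) ∪ p₃ ∣ ≤ 9
  ∣p∣≤9 = ℕ.≤-trans (∣p∪q∣≤∣p∣+∣q∣ (p₁ ∪ p₂) p₃)
            (ℕ.+-mono-≤ (ℕ.≤-trans (∣p∪q∣≤∣p∣+∣q∣ p₁ p₂) (ℕ.+-mono-≤ small₁ small₂)) small₃)
  j = proj₁ (∣p∣<n⇒∃∉ ((p₁ ∪ p₂) ∪ p₃) (s≤s ∣p∣≤9))
  j∉ = proj₂ (∣p∣<n⇒∃∉ ((p₁ ∪ p₂) ∪ p₃) (s≤s ∣p∣≤9))
  ∈ˡ : ∀ {p q : Subset 10} → j ∈ p → j ∈ p ∪ q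
  ∈ˡ {p} {q} = x∈p∪q⁺ {p = p} {q = q} ∘ inj₁
  ∈ʳ : ∀ {p q : Subset 10} → j ∈ q → j ∈ p ∪ q
  ∈ʳ {p} {q} = x∈p∪q⁺ {p = p} {q = q} ∘ inj₂
  moves : ∀ {S} → (j ∈ stabiliser S → j ∈ (p₁ ∪ p₂) ∪ p₃) → Moves S (offC5 j)
  moves into = ¬stabilises⇒moves (j∉ ∘ into ∘ ⇒∈stabiliser)

-- Cosets of a flat

-- E ∩ (x + ⟨F⟩), coordinatised by f : F₂ᵏ ≅ ⟨F⟩.
trace : (M : Matroid) {k : ℕ} → (Pt k → Pt (dim M)) → Pt (dim M) → Pt k → Bool
trace M f x a = E M (x ⊕ f a)

trace-sumAvoids : (M : Matroid) → TriangleFree M → ∀ {k} {f : Pt k → Pt (dim M)} →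
  Linear f → Injective f → ∀ x → SumAvoids (E M ∘ f) (trace M f x)
trace-sumAvoids M triangle-free {f = f} f-lin f-inj x a b xa∈E xb∈E with a ≟ᵥ b
... | yes refl = begin
  E M (f (a ⊕ a))  ≡⟨ cong (E M ∘ f) (⊕-self a) ⟩
  E M (f 𝟘)        ≡⟨ cong (E M) (linear-𝟘 f-lin) ⟩
  E M 𝟘            ≡⟨ E-0 M ⟩
  false            ∎
... | no a≢b = begin
  E M (f (a ⊕ b))              ≡⟨ cong (E M) (f-lin a b) ⟩
  E M (f a ⊕ f b)              ≡⟨ cong (E M) ([x⊕y]⊕[x⊕z]≡y⊕z x (f a) (f b)) ⟨
  E M ((x ⊕ f a) ⊕ (x ⊕ f b))  ≡⟨ triangle-free _ _ (a≢b ∘ f-inj a b ∘ ⊕-cancelˡ x) xa∈E xb∈E ⟩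
  false                        ∎

contraction-trace : (M : Matroid) {k l : ℕ} (φ : Embedding k (dim M)) (χ : Embedding l (dim M))
  (N : Matroid) (h : Embedding (dim N) l) → RestrIso (contraction M φ χ) N h →
  ∀ w → w ≢ 𝟘 → anyVec k (trace M (proj₁ φ) (proj₁ χ (proj₁ h w))) ≡ E N w
contraction-trace M {k} φ χ N (h , h-lin , h-inj) h-iso w w≢𝟘 =
  trans (cong (λ b → not b ∧ anyVec k _) (sym hw≢𝟘)) (h-iso w)
  where
  hw≢𝟘 : isZero (h w) ≡ false
  hw≢𝟘 with isZero (h w) in hw
  ... | false = refl
  ... | true  = contradiction (h-inj w 𝟘 (trans (isZero⇒≡𝟘 (h w) hw) (sym (linear-𝟘 h-lin)))) w≢𝟘

C5∋⇒≢𝟘 : ∀ {v} → E C5 v ≡ true → v ≢ 𝟘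
C5∋⇒≢𝟘 () refl

ε₁ ε₂ ε₃ : Pt 3
ε₁ = true  ∷ false ∷ false ∷ []
ε₂ = false ∷ true  ∷ false ∷ []
ε₃ = false ∷ false ∷ true  ∷ []

module I₅Construction
  (M : Matroid) (triangle-free : TriangleFree M)
  (f : Pt 4 → Pt (dim M)) (f-lin : Linear f) (f-inj : Injective f) (f-C5 : ∀ v → E M (f v) ≡ E C5 v)
  (G : Pt 3 → Pt (dim M)) (G-lin : Linear G) (G-apart : ∀ x a → G x ≡ f a → x ≡ 𝟘)
  (G-I₃ : ∀ w → w ≢ 𝟘 → anyVec 4 (trace M f (G w)) ≡ (weight w ≡ᵇ 1))
  where

  T : Pt 3 → Pt 4 → Bool
  T w = trace M f (G w)

  T-𝟘 : ∀ a → T 𝟘 a ≡ E C5 a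
  T-𝟘 a = begin
    E M (G 𝟘 ⊕ f a)  ≡⟨ cong (λ x → E M (x ⊕ f a)) (linear-𝟘 G-lin) ⟩
    E M (𝟘 ⊕ f a)    ≡⟨ cong (E M) (⊕-identityˡ (f a)) ⟩
    E M (f a)        ≡⟨ f-C5 a ⟩
    E C5 a           ∎

  T-sumAvoids : ∀ w → SumAvoids (E C5) (T w)
  T-sumAvoids w a b Ta Tb =
    trans (sym (f-C5 (a ⊕ b))) (trace-sumAvoids M triangle-free f-lin f-inj (G w) a b Ta Tb)

  T-nonempty : ∀ w → w ≢ 𝟘 → (weight w ≡ᵇ 1) ≡ true → ∃ λ a → T w a ≡ true
  T-nonempty w w≢𝟘 unit = anyVec-witness 4 (T w) (trans (G-I₃ w w≢𝟘) unit)

  T-empty : ∀ w → w ≢ 𝟘 → (weight w ≡ᵇ 1) ≡ false → ∀ a → T w a ≡ false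
  T-empty w w≢𝟘 nonunit = anyVec-false 4 (T w) (trans (G-I₃ w w≢𝟘) nonunit)

  moving-offC5 : ∃ λ j → Moves (T ε₁) (offC5 j) × Moves (T ε₂) (offC5 j) × Moves (T ε₃) (offC5 j)
  moving-offC5 =
    common-moving-offC5 (small ε₁ (λ ()) refl) (small ε₂ (λ ()) refl) (small ε₃ (λ ()) refl)
    where
    small : ∀ w → w ≢ 𝟘 → (weight w ≡ᵇ 1) ≡ true → ∣ stabiliser (T w) ∣ ≤ 3
    small w w≢𝟘 unit = ∣stabiliser∣≤3 (T-sumAvoids w) (T-nonempty w w≢𝟘 unit)

  module Lift (c d : Pt 4) (c∈C5 : E C5 c ≡ true) (d∈C5 : E C5 d ≡ true)
              (c⊕d∉C5 : E C5 (c ⊕ d) ≡ false) (c⊕d≢𝟘 : c ⊕ d ≢ 𝟘)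
              (m₁ : Moves (T ε₁) (c ⊕ d)) (m₂ : Moves (T ε₂) (c ⊕ d)) (m₃ : Moves (T ε₃) (c ⊕ d))
              where

    spanned : Pt 2 → Pt 4
    spanned = linComb (c ∷ d ∷ [])

    lifts : Vec (Pt 4) 5
    lifts = proj₁ m₁ ∷ proj₁ m₂ ∷ proj₁ m₃ ∷ c ∷ d ∷ []

    θ : Pt 5 → Pt (dim M)
    θ (x₁ ∷ x₂ ∷ x₃ ∷ y) = G (x₁ ∷ x₂ ∷ x₃ ∷ []) ⊕ f (linComb lifts (x₁ ∷ x₂ ∷ x₃ ∷ y))

    θ-linear : Linear θ
    θ-linear (x₁ ∷ x₂ ∷ x₃ ∷ y) (x₁′ ∷ x₂′ ∷ x₃′ ∷ y′) =
      trans (cong₂ _⊕_ (G-lin (x₁ ∷ x₂ ∷ x₃ ∷ []) (x₁′ ∷ x₂′ ∷ x₃′ ∷ []))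
                       (∘-linear f-lin (linComb-linear lifts) (x₁ ∷ x₂ ∷ x₃ ∷ y) (x₁′ ∷ x₂′ ∷ x₃′ ∷ y′)))
            (⊕-interchange _ _ _ _)

    spanned-independent : ∀ y → spanned y ≡ 𝟘 → y ≡ 𝟘
    spanned-independent (false ∷ false ∷ []) _ = refl
    spanned-independent (true  ∷ false ∷ []) e =
      contradiction (trans (sym (⊕-identityʳ c)) e) (C5∋⇒≢𝟘 c∈C5)
    spanned-independent (false ∷ true  ∷ []) e =
      contradiction (trans (sym (⊕-identityʳ d)) e) (C5∋⇒≢𝟘 d∈C5)
    spanned-independent (true  ∷ true  ∷ []) e =
      contradiction (trans (cong (c ⊕_) (sym (⊕-identityʳ d))) e) c⊕d≢𝟘

    θ-kernel : ∀ z → θ z ≡ 𝟘 → z ≡ 𝟘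
    θ-kernel (x₁ ∷ x₂ ∷ x₃ ∷ y) θz≡𝟘 with G-apart (x₁ ∷ x₂ ∷ x₃ ∷ []) _ (⊕≡𝟘⇒≡ θz≡𝟘)
    ... | refl = cong (λ y → false ∷ false ∷ false ∷ y) (spanned-independent y (f-inj _ 𝟘 fy≡f𝟘))
      where
      fy≡f𝟘 : f (spanned y) ≡ f 𝟘
      fy≡f𝟘 = begin
        f (spanned y)        ≡⟨ ⊕-identityˡ _ ⟨
        𝟘 ⊕ f (spanned y)    ≡⟨ cong (_⊕ f (spanned y)) (linear-𝟘 G-lin) ⟨
        G 𝟘 ⊕ f (spanned y)  ≡⟨ θz≡𝟘 ⟩
        𝟘                    ≡⟨ linear-𝟘 f-lin ⟨
        f 𝟘                  ∎

    spanned-C5 : ∀ y → E C5 (spanned y) ≡ (weight y ≡ᵇ 1)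
    spanned-C5 (false ∷ false ∷ []) = refl
    spanned-C5 (true  ∷ false ∷ []) = trans (cong (E C5) (⊕-identityʳ c)) c∈C5
    spanned-C5 (false ∷ true  ∷ []) = trans (cong (E C5) (⊕-identityʳ d)) d∈C5
    spanned-C5 (true  ∷ true  ∷ []) = trans (cong (λ u → E C5 (c ⊕ u)) (⊕-identityʳ d)) c⊕d∉C5

    moved-spanned : ∀ {S} → SumAvoids (E C5) S → ((a , _) : Moves S (c ⊕ d)) →
      ∀ y → S (a ⊕ spanned y) ≡ (weight y ≡ᵇ 0)
    moved-spanned {S} avoids (a , Sa , _) (false ∷ false ∷ []) = trans (cong S (⊕-identityʳ a)) Sa
    moved-spanned {S} avoids (a , Sa , _) (true  ∷ false ∷ []) =
      trans (cong (λ u → S (a ⊕ u)) (⊕-identityʳ c)) (shift-leaves avoids Sa c∈C5)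
    moved-spanned {S} avoids (a , Sa , _) (false ∷ true  ∷ []) =
      trans (cong (λ u → S (a ⊕ u)) (⊕-identityʳ d)) (shift-leaves avoids Sa d∈C5)
    moved-spanned {S} avoids (a , _ , Sa⊕c⊕d) (true  ∷ true  ∷ []) =
      trans (cong (λ u → S (a ⊕ (c ⊕ u))) (⊕-identityʳ d)) Sa⊕c⊕d

    θ-I₅ : ∀ z → E M (θ z) ≡ (weight z ≡ᵇ 1)
    θ-I₅ (false ∷ false ∷ false ∷ y) = trans (T-𝟘 (spanned y)) (spanned-C5 y)
    θ-I₅ (true  ∷ false ∷ false ∷ y) = moved-spanned (T-sumAvoids ε₁) m₁ y
    θ-I₅ (false ∷ true  ∷ false ∷ y) = moved-spanned (T-sumAvoids ε₂) m₂ y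
    θ-I₅ (false ∷ false ∷ true  ∷ y) = moved-spanned (T-sumAvoids ε₃) m₃ y
    θ-I₅ (true  ∷ true  ∷ false ∷ y) = T-empty _ (λ ()) refl _
    θ-I₅ (true  ∷ false ∷ true  ∷ y) = T-empty _ (λ ()) refl _
    θ-I₅ (false ∷ true  ∷ true  ∷ y) = T-empty _ (λ ()) refl _
    θ-I₅ (true  ∷ true  ∷ true  ∷ y) = T-empty _ (λ ()) refl _

    I₅-restriction : Σ (Embedding 5 (dim M)) (RestrIso M (I 5))
    I₅-restriction = (θ , θ-linear , trivialKernel⇒injective θ-linear θ-kernel) , θ-I₅

  I₅-restriction : Σ (Embedding 5 (dim M)) (RestrIso M (I 5))
  I₅-restriction =
    let j , m₁ , m₂ , m₃              = moving-offC5
        j≢𝟘 , j∉C5                    = offC5-off j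
        c , d , c∈C5 , d∈C5 , c⊕d≡j  = C5-chord (offC5 j) j∉C5
        at-chord : ∀ {S} → Moves S (offC5 j) → Moves S (c ⊕ d)
        at-chord = subst (Moves _) (sym c⊕d≡j)
    in  Lift.I₅-restriction c d c∈C5 d∈C5
          (subst (λ v → E C5 v ≡ false) (sym c⊕d≡j) j∉C5) (subst (_≢ 𝟘) (sym c⊕d≡j) j≢𝟘)
          (at-chord m₁) (at-chord m₂) (at-chord m₃)

lemma3p1 : (M : Matroid) → FullRank M → Free M (I 5) → TriangleFree M →
    (φ : Embedding 4 (dim M)) → RestrIso M C5 φ →
    (m : ℕ) → m + 4 ≡ dim M → (χ : Embedding m (dim M)) → Complementary φ χ →
    Free (contraction M φ χ) (I 3)
lemma3p1 M _ I₅-free triangle-free φ@(f , f-lin , f-inj) f-C5 m _ χ@(g , g-lin , _) complementary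
         (η@(h , h-lin , h-inj) , h-I₃) =
  I₅-free (I₅Construction.I₅-restriction M triangle-free f f-lin f-inj f-C5
             (g ∘ h) (∘-linear g-lin h-lin) G-apart (contraction-trace M φ χ (I 3) η h-I₃))
  where
  G-apart : ∀ x a → g (h x) ≡ f a → x ≡ 𝟘
  G-apart x a gh≡f = h-inj x 𝟘 (trans (complementary (h x) a gh≡f) (sym (linear-𝟘 h-lin)))
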